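{- Let $m, q_1, q_2, s_1, s_2$ be positive integers, and let $q = q_1 q_2$ and $s = s_1 s_2$. Suppose that for both $i = 1$ and $i = 2$, for every path and every partition $V_1 \sqcup \dots \sqcup V_m$ of its vertex set into $m$ parts with $|V_j| \ge q_i - 1$ for all $j$, there is an almost fair splitting by $q_i$ pairwise disjoint $s_i$-stable sets $A^{(i)}_1, \dots, A^{(i)}_{q_i}$. Then for every path and every partition $V_1 \sqcup \dots \sqcup V_m$ of its vertex set with $|V_j| \ge q-1$ for all $j$ there is an almost fair splitting by $q$ pairwise disjoint $s$-stable sets $S_1, \dots, S_q$. If moreover (in the hypothesis for $i=1$) the sets $A^{(1)}_1, \dots, A^{(1)}_{q_1}$ can always be chosen to be weakly $w_1$-stable for some fixed $w_1 \ge 2$, then there is an almost fair splitting by $q$ pairwise disjoint $[(s_2-1)(w_1-1)+1]$-stable sets $S_1, \dots, S_q$.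
   Context: A set $S$ of vertices of a path is $s$-stable if any two distinct vertices of $S$ are at distance at least $s$ in the path. Given a partition $V_1 \sqcup \dots \sqcup V_m$ of the vertex set, pairwise disjoint sets $S_1, \dots, S_r$ form an almost fair splitting (by $r$ sets) if $|S_i \cap V_j| \ge \lfloor \frac{|V_j|+1}{r} \rfloor - 1$ for all $i,j$ and $|V_j \setminus \bigcup_i S_i| \le r-1$ for all $j$. Weak stability: pairwise disjoint vertex sets $A_1, \dots, A_r$ of a path with vertices labeled $1, \dots, N$ in order are weakly $w$-stable if $|\bigcup_i A_i| = (w-1)n'+1$ for some integer $n'$ and, with $\varphi\colon \bigcup_i A_i \to \{1, \dots, (w-1)n'+1\}$ the order-preserving bijection, for every $i$ and every $k \in \{1, \dots, n'\}$ the set $\varphi(A_i) \cap \{(w-1)(k-1)+1, \dots, (w-1)k+1\}$ consists of exactly one point. -}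

module Defs where

open import Data.Bool using (Bool; true; false; _∧_)
open import Data.Nat using (ℕ; zero; suc; _+_; _*_; _∸_; _/_; _≤_; _≤ᵇ_; ∣_-_∣; NonZero)
open import Data.Fin using (Fin; toℕ) renaming (zero to fzero; suc to fsuc)
open import Data.Unit using (⊤)
open import Data.Fin.Subset using (Subset; _∈_; _∩_; _∪_; _─_; ∣_∣; Empty; ⊥)
open import Data.Fin.Properties using (_≟_)
open import Data.Vec using (tabulate; lookup)
open import Data.Product using (Σ; _×_; ∃)
open import Relation.Nullary using (¬_)
open import Relation.Nullary.Decidable using (⌊_⌋)
open import Relation.Binary.PropositionalEquality using (_≡_)

-- A path on N vertices: vertices are Fin N, vertex x is labelled toℕ x + 1,
-- consecutive labels are adjacent.  Distance in the path:
dist : ∀ {N} → Fin N → Fin N → ℕ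
dist x y = ∣ toℕ x - toℕ y ∣

Stable : ∀ {N} → ℕ → Subset N → Set
Stable s S = ∀ x y → x ∈ S → y ∈ S → ¬ (x ≡ y) → s ≤ dist x y

Part : ∀ {N m} → (Fin N → Fin m) → Fin m → Subset N
Part c j = tabulate (λ x → ⌊ c x ≟ j ⌋)

Union : ∀ {N r} → (Fin r → Subset N) → Subset N
Union {r = zero}  A = ⊥
Union {r = suc r} A = A fzero ∪ Union (λ i → A (fsuc i))

PairwiseDisjoint : ∀ {N r} → (Fin r → Subset N) → Set
PairwiseDisjoint A = ∀ i i' → ¬ (i ≡ i') → Empty (A i ∩ A i')

-- Almost fair splitting by r sets (the sets are additionally required to be
-- pairwise disjoint via PairwiseDisjoint).  ⌊(|V_j|+1)/r⌋ - 1 uses truncated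
-- subtraction, which is harmless since cardinalities are ≥ 0.
AlmostFair : ∀ {N m} (r : ℕ) → .{{_ : NonZero r}} →
             (Fin N → Fin m) → (Fin r → Subset N) → Set
AlmostFair r c A =
  (∀ i j → ((∣ Part c j ∣ + 1) / r) ∸ 1 ≤ ∣ A i ∩ Part c j ∣) ×
  (∀ j → ∣ Part c j ─ Union A ∣ ≤ r ∸ 1)

-- φ(x) for x in U: position of x in U (1-based), order preserving.
rank : ∀ {N} → Subset N → Fin N → ℕ
rank U x = ∣ U ∩ tabulate (λ y → toℕ y ≤ᵇ toℕ x) ∣

Window : ∀ {N} → Subset N → ℕ → ℕ → Subset N
Window U a b = tabulate (λ x → lookup U x ∧ ((a ≤ᵇ rank U x) ∧ (rank U x ≤ᵇ b)))

WeaklyStable : ∀ {N r} → ℕ → (Fin r → Subset N) → Set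
WeaklyStable w A =
  Σ ℕ (λ n' → (∣ Union A ∣ ≡ (w ∸ 1) * n' + 1) ×
     (∀ i (k : ℕ) → 1 ≤ k → k ≤ n' →
        ∣ A i ∩ Window (Union A) ((w ∸ 1) * (k ∸ 1) + 1) ((w ∸ 1) * k + 1) ∣ ≡ 1))

Splittable : (m q s : ℕ) → .{{_ : NonZero q}} →
             (∀ {N} → (Fin q → Subset N) → Set) → Set
Splittable m q s P =
  ∀ (N : ℕ) (c : Fin N → Fin m) → (∀ j → q ∸ 1 ≤ ∣ Part c j ∣) →
  Σ (Fin q → Subset N) (λ A →
    PairwiseDisjoint A × (∀ i → Stable s (A i)) × AlmostFair q c A × P A)

NoExtra : ∀ {N r} → (Fin r → Subset N) → Set
NoExtra _ = ⊤

module Submission where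

-- Given a path and a partition V₁ ⊔ … ⊔ Vₘ, first split the path into q₁
-- sets A₁ … A_{q₁} by the first hypothesis.  Each Aₖ, with the vertex order
-- it inherits, is again a path (the induced path, `emb`/`push` below), and
-- the parts Vⱼ ∩ Aₖ are large enough for the second hypothesis to split it
-- into q₂ sets Bₖₗ.  The q₁q₂ sets Bₖₗ, pushed back into the original path,
-- form the required almost fair splitting.  This refinement step (module
-- `Refinement`) is proved once, assuming only that the induced paths stretch
-- distance s₂ to distance s (`Stretches`).  Two stretching lemmas then give
-- the two halves of the theorem:
--   * an s₁-stable set multiplies distances by at least s₁
--     (`stable-stretches`), giving s₁s₂-stability;
--   * a member of a weakly w-stable family has at most one point in each
--     window of w consecutive ranks of the union, so t + 2 of its consecutive
--     points span at least t(w - 1) + 1 positions (`weakly-stable-stretches`,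
--     via the gap lemma of module `RankWindows`).

open import Defs
open import Data.Nat using (ℕ; _*_; _+_; _∸_; _≤_; NonZero)
open import Data.Nat.Properties using (m*n≢0)
open import Data.Product using (_×_)

open import Algebra.Properties.CommutativeSemigroup using (interchange)
open import Data.Bool using (Bool; true; false; _∧_; _∨_; not)
open import Data.Bool.Properties using (T-≡; ∧-zeroʳ; ∧-identityʳ; ∨-zeroʳ)
open import Data.Empty using (⊥; ⊥-elim)
open import Data.Fin using (Fin; toℕ; remQuot; combine) renaming (zero to fzero; suc to fsuc)
open import Data.Fin.Properties using (toℕ-injective; toℕ<n; remQuot-combine; combine-remQuot)
  renaming (_≟_ to _≟ᶠ_; suc-injective to fsuc-injective)
open import Data.Fin.Subset using (Subset; _∈_; _∩_; _─_; ∣_∣; Empty)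
open import Data.Nat using (suc; zero; _<_; _≤ᵇ_; _<ᵇ_; _≤?_; z≤n; s≤s; _/_; _%_)
open import Data.Nat.DivMod using (m*n/n≡m; /-monoˡ-≤; m/n/o≡m/[n*o]; m/n*n≤m; m%n<n; m≡m%n+[m/n]*n)
open import Data.Nat.Properties
open import Data.Product using (Σ; _,_; proj₁; proj₂; uncurry)
open import Data.Sum using (inj₁; inj₂)
open import Data.Unit using (tt)
open import Data.Vec using (_∷_; []; lookup)
open import Data.Vec.Properties using (lookup-zipWith; lookup-replicate; lookup∘tabulate; []=⇒lookup; lookup⇒[]=)
open import Function using (_∘_; case_of_)
open import Function.Bundles using (Equivalence)
open import Relation.Binary.PropositionalEquality
open import Relation.Nullary using (¬_; yes; no)

open ≤-Reasoning

∧-true : ∀ a {b} → a ∧ b ≡ true → (a ≡ true) × (b ≡ true)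
∧-true true {true} _ = refl , refl

not-true : ∀ {b} → not b ≡ true → b ≡ false
not-true {false} _ = refl

≤ᵇ-sound : ∀ m n → (m ≤ᵇ n) ≡ true → m ≤ n
≤ᵇ-sound m n h = ≤ᵇ⇒≤ m n (Equivalence.from T-≡ h)

≤ᵇ-complete : ∀ {m n} → m ≤ n → (m ≤ᵇ n) ≡ true
≤ᵇ-complete h = Equivalence.to T-≡ (≤⇒≤ᵇ h)

≤ᵇ-false : ∀ m n → (m ≤ᵇ n) ≡ false → n < m
≤ᵇ-false m n h with m ≤? n
... | yes m≤n = case trans (sym (≤ᵇ-complete m≤n)) h of λ ()
... | no m≰n = ≰⇒> m≰n

≤ᵇ-suc : ∀ m n → (suc m ≤ᵇ suc n) ≡ (m ≤ᵇ n)
≤ᵇ-suc zero n = refl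
≤ᵇ-suc (suc m) n = refl

m+n≤o⇒n≤o∸m : ∀ m {n o} → m + n ≤ o → n ≤ o ∸ m
m+n≤o⇒n≤o∸m m {n} {o} h = m+n≤o⇒m≤o∸n n (subst (_≤ o) (+-comm m n) h)

bit : Bool → ℕ
bit true = 1
bit false = 0

count : ∀ {N} → (Fin N → Bool) → ℕ
count {zero} f = 0
count {suc N} f = bit (f fzero) + count (f ∘ fsuc)

count-cong : ∀ {N} {f g : Fin N → Bool} → (∀ x → f x ≡ g x) → count f ≡ count g
count-cong {zero} e = refl
count-cong {suc N} e = cong₂ _+_ (cong bit (e fzero)) (count-cong (e ∘ fsuc))

count-mono : ∀ {N} {f g : Fin N → Bool} → (∀ x → f x ≡ true → g x ≡ true) → count f ≤ count g
count-mono {zero} h = z≤n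
count-mono {suc N} h = +-mono-≤ (bit-mono (h fzero)) (count-mono (h ∘ fsuc))
  where
  bit-mono : ∀ {a b} → (a ≡ true → b ≡ true) → bit a ≤ bit b
  bit-mono {false} _ = z≤n
  bit-mono {true} h rewrite h refl = ≤-refl

count-none : ∀ {N} {f : Fin N → Bool} → (∀ x → f x ≡ false) → count f ≡ 0
count-none {zero} h = refl
count-none {suc N} h rewrite h fzero = count-none (h ∘ fsuc)

count-pos : ∀ {N} (f : Fin N → Bool) x → f x ≡ true → 1 ≤ count f
count-pos f fzero h rewrite h = s≤s z≤n
count-pos f (fsuc x) h = ≤-trans (count-pos (f ∘ fsuc) x h) (m≤n+m _ _)

+-interchange : ∀ a b c d → (a + b) + (c + d) ≡ (a + c) + (b + d)
+-interchange = interchange +-commutativeSemigroup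

count-split : ∀ {N} (f g : Fin N → Bool) →
  count f ≡ count (λ x → f x ∧ g x) + count (λ x → f x ∧ not (g x))
count-split {zero} f g = refl
count-split {suc N} f g = trans
  (cong₂ _+_ (bit-split (f fzero) (g fzero)) (count-split (f ∘ fsuc) (g ∘ fsuc)))
  (+-interchange (bit (f fzero ∧ g fzero)) (bit (f fzero ∧ not (g fzero)))
                 (count (λ x → f (fsuc x) ∧ g (fsuc x))) (count (λ x → f (fsuc x) ∧ not (g (fsuc x)))))
  where
  bit-split : ∀ a b → bit a ≡ bit (a ∧ b) + bit (a ∧ not b)
  bit-split false b = refl
  bit-split true false = refl
  bit-split true true = refl

count-∨ : ∀ {N} (f g : Fin N → Bool) → count (λ x → f x ∨ g x) ≤ count f + count g
count-∨ {zero} f g = z≤n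
count-∨ {suc N} f g = begin
  bit (f fzero ∨ g fzero) + count (λ x → f (fsuc x) ∨ g (fsuc x))
    ≤⟨ +-mono-≤ (bit-∨ (f fzero) (g fzero)) (count-∨ (f ∘ fsuc) (g ∘ fsuc)) ⟩
  (bit (f fzero) + bit (g fzero)) + (count (f ∘ fsuc) + count (g ∘ fsuc))
    ≡⟨ +-interchange (bit (f fzero)) (bit (g fzero)) (count (f ∘ fsuc)) (count (g ∘ fsuc)) ⟩
  count f + count g ∎
  where
  bit-∨ : ∀ a b → bit (a ∨ b) ≤ bit a + bit b
  bit-∨ false b = ≤-refl
  bit-∨ true b = s≤s z≤n

count-interval : ∀ {n} lo hi → hi < n →
  count {n} (λ y → (lo ≤ᵇ toℕ y) ∧ (toℕ y ≤ᵇ hi)) ≡ suc hi ∸ lo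
count-interval {suc n} zero zero _ = cong suc (count-none {n} (λ _ → refl))
count-interval {suc n} zero (suc hi) (s≤s h) =
  cong suc (trans (count-cong {n} (λ y → ≤ᵇ-suc (toℕ y) hi)) (count-interval zero hi h))
count-interval {suc n} (suc lo) zero _ =
  trans (count-none {n} (λ x → ∧-zeroʳ (lo <ᵇ suc (toℕ x)))) (sym (0∸n≡0 lo))
count-interval {suc n} (suc lo) (suc hi) (s≤s h) =
  trans (count-cong {n} (λ y → cong₂ _∧_ (≤ᵇ-suc lo (toℕ y)) (≤ᵇ-suc (toℕ y) hi))) (count-interval lo hi h)

any : ∀ {r} → (Fin r → Bool) → Bool
any {zero} h = false
any {suc r} h = h fzero ∨ any (h ∘ fsuc)

any-intro : ∀ {r} (h : Fin r → Bool) i → h i ≡ true → any h ≡ true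
any-intro h fzero e rewrite e = refl
any-intro h (fsuc i) e rewrite any-intro (h ∘ fsuc) i e = ∨-zeroʳ (h fzero)

any-elim : ∀ {r} (h : Fin r → Bool) → any h ≡ true → Σ (Fin r) (λ i → h i ≡ true)
any-elim {suc r} h e with h fzero in eq
... | true = fzero , eq
... | false with any-elim (h ∘ fsuc) e
... | i , p = fsuc i , p

any-none : ∀ {r} (h : Fin r → Bool) → (∀ i → h i ≡ false) → any h ≡ false
any-none {zero} h e = refl
any-none {suc r} h e rewrite e fzero = any-none (h ∘ fsuc) (e ∘ fsuc)

any-false : ∀ {r} (h : Fin r → Bool) → any h ≡ false → ∀ i → h i ≡ false
any-false h e i with h i in eq
... | false = refl
... | true = case trans (sym (any-intro h i eq)) e of λ ()

any-cong : ∀ {r} {h h' : Fin r → Bool} → (∀ i → h i ≡ h' i) → any h ≡ any h'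
any-cong {zero} e = refl
any-cong {suc r} e = cong₂ _∨_ (e fzero) (any-cong (e ∘ fsuc))

count-any : ∀ {N r} (h : Fin r → Fin N → Bool) b → (∀ i → count (h i) ≤ b) →
  count (λ x → any (λ i → h i x)) ≤ r * b
count-any {N} {zero} h b _ = ≤-reflexive (count-none {N} (λ _ → refl))
count-any {r = suc r} h b hb = begin
  count (λ x → h fzero x ∨ any (λ i → h (fsuc i) x))
    ≤⟨ count-∨ (h fzero) _ ⟩
  count (h fzero) + count (λ x → any (λ i → h (fsuc i) x))
    ≤⟨ +-mono-≤ (hb fzero) (count-any (h ∘ fsuc) b (hb ∘ fsuc)) ⟩
  b + r * b ∎

∈⇒true : ∀ {N} {p : Subset N} {x} → x ∈ p → lookup p x ≡ true
∈⇒true = []=⇒lookup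

true⇒∈ : ∀ {N} {p : Subset N} {x} → lookup p x ≡ true → x ∈ p
true⇒∈ {p = p} {x} = lookup⇒[]= x p

lookup-∩ : ∀ {N} (p q : Subset N) x → lookup (p ∩ q) x ≡ (lookup p x ∧ lookup q x)
lookup-∩ p q x = lookup-zipWith _∧_ x p q

lookup-─ : ∀ {N} (p q : Subset N) x → lookup (p ─ q) x ≡ (lookup p x ∧ not (lookup q x))
lookup-─ (a ∷ p) (true ∷ q) fzero = sym (∧-zeroʳ a)
lookup-─ (a ∷ p) (false ∷ q) fzero = sym (∧-identityʳ a)
lookup-─ (a ∷ p) (b ∷ q) (fsuc x) = lookup-─ p q x

lookup-Union : ∀ {N r} (A : Fin r → Subset N) x → lookup (Union A) x ≡ any (λ i → lookup (A i) x)
lookup-Union {r = zero} A x = lookup-replicate x false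
lookup-Union {r = suc r} A x = trans (lookup-zipWith _∨_ x (A fzero) (Union (A ∘ fsuc)))
  (cong (lookup (A fzero) x ∨_) (lookup-Union (A ∘ fsuc) x))

∣∣≡count : ∀ {N} (p : Subset N) → ∣ p ∣ ≡ count (lookup p)
∣∣≡count [] = refl
∣∣≡count (true ∷ p) = cong suc (∣∣≡count p)
∣∣≡count (false ∷ p) = ∣∣≡count p

∣∩∣≡count : ∀ {N} (p q : Subset N) → ∣ p ∩ q ∣ ≡ count (λ x → lookup p x ∧ lookup q x)
∣∩∣≡count p q = trans (∣∣≡count (p ∩ q)) (count-cong (lookup-∩ p q))

∣─Union∣≡count : ∀ {N r} (p : Subset N) (A : Fin r → Subset N) →
  ∣ p ─ Union A ∣ ≡ count (λ x → lookup p x ∧ not (any (λ i → lookup (A i) x)))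
∣─Union∣≡count p A = trans (∣∣≡count (p ─ Union A)) (count-cong (λ x →
  trans (lookup-─ p (Union A) x) (cong (λ u → lookup p x ∧ not u) (lookup-Union A x))))

-- The induced path on a subset A: its vertices Fin ∣ A ∣ are the elements of
-- A in increasing order, `emb A` lists them, and `push A B` is the image of a
-- subset B of the induced path.

emb : ∀ {N} (A : Subset N) → Fin ∣ A ∣ → Fin N
emb (true ∷ A) fzero = fzero
emb (true ∷ A) (fsuc y) = fsuc (emb A y)
emb (false ∷ A) y = fsuc (emb A y)

push : ∀ {N} (A : Subset N) → Subset ∣ A ∣ → Subset N
push [] B = []
push (true ∷ A) (b ∷ B) = b ∷ push A B
push (false ∷ A) B = false ∷ push A B

emb-∈ : ∀ {N} (A : Subset N) y → lookup A (emb A y) ≡ true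
emb-∈ (true ∷ A) fzero = refl
emb-∈ (true ∷ A) (fsuc y) = emb-∈ A y
emb-∈ (false ∷ A) y = emb-∈ A y

emb-injective : ∀ {N} (A : Subset N) a b → emb A a ≡ emb A b → a ≡ b
emb-injective (true ∷ A) fzero fzero e = refl
emb-injective (true ∷ A) (fsuc a) (fsuc b) e = cong fsuc (emb-injective A a b (fsuc-injective e))
emb-injective (false ∷ A) a b e = emb-injective A a b (fsuc-injective e)

emb-mono : ∀ {N} (A : Subset N) a b → toℕ a ≤ toℕ b → toℕ (emb A a) ≤ toℕ (emb A b)
emb-mono (true ∷ A) fzero b h = z≤n
emb-mono (true ∷ A) (fsuc a) (fsuc b) (s≤s h) = s≤s (emb-mono A a b h)
emb-mono (false ∷ A) a b h = s≤s (emb-mono A a b h)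

push-⊆ : ∀ {N} (A : Subset N) B x → lookup (push A B) x ≡ true → lookup A x ≡ true
push-⊆ (true ∷ A) (b ∷ B) fzero h = refl
push-⊆ (true ∷ A) (b ∷ B) (fsuc x) h = push-⊆ A B x h
push-⊆ (false ∷ A) B (fsuc x) h = push-⊆ A B x h

push-emb : ∀ {N} (A : Subset N) B y → lookup (push A B) (emb A y) ≡ lookup B y
push-emb (true ∷ A) (b ∷ B) fzero = refl
push-emb (true ∷ A) (b ∷ B) (fsuc y) = push-emb A B y
push-emb (false ∷ A) B y = push-emb A B y

push-preimage : ∀ {N} (A : Subset N) B x → lookup (push A B) x ≡ true →
  Σ (Fin ∣ A ∣) (λ y → (emb A y ≡ x) × (lookup B y ≡ true))
push-preimage (true ∷ A) (b ∷ B) fzero h = fzero , refl , h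
push-preimage (true ∷ A) (b ∷ B) (fsuc x) h with push-preimage A B x h
... | y , refl , hy = fsuc y , refl , hy
push-preimage (false ∷ A) B (fsuc x) h with push-preimage A B x h
... | y , refl , hy = y , refl , hy

count-emb : ∀ {N} (A : Subset N) (f : Fin N → Bool) →
  count (λ x → lookup A x ∧ f x) ≡ count (f ∘ emb A)
count-emb [] f = refl
count-emb (true ∷ A) f = cong (bit (f fzero) +_) (count-emb A (f ∘ fsuc))
count-emb (false ∷ A) f = count-emb A (f ∘ fsuc)

count-within : ∀ {N} (A : Subset N) (f : Fin N → Bool) → (∀ x → f x ≡ true → lookup A x ≡ true) →
  count f ≡ count (f ∘ emb A)
count-within A f f⊆A = trans (count-cong absorb) (count-emb A f)
  where
  absorb : ∀ x → f x ≡ (lookup A x ∧ f x)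
  absorb x with f x in eq
  ... | false = sym (∧-zeroʳ (lookup A x))
  ... | true rewrite f⊆A x eq = refl

Stretches : ∀ {N} → Subset N → ℕ → ℕ → Set
Stretches A s' s = ∀ a b → ¬ a ≡ b → s' ≤ dist a b → s ≤ dist (emb A a) (emb A b)

push-stable : ∀ {N} {s' s} (A : Subset N) (B : Subset ∣ A ∣) →
  Stretches A s' s → Stable s' B → Stable s (push A B)
push-stable A B stretch stableB x y x∈ y∈ x≢y
  with push-preimage A B x (∈⇒true x∈) | push-preimage A B y (∈⇒true y∈)
... | a , refl , a∈B | b , refl , b∈B =
  stretch a b a≢b (stableB a b (true⇒∈ a∈B) (true⇒∈ b∈B) a≢b)
  where
  a≢b : ¬ a ≡ b
  a≢b a≡b = x≢y (cong (emb A) a≡b)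

-- Since emb A is monotone, a relation between distances in the induced path
-- and in the path only needs to be checked on ordered pairs.
emb-dist : ∀ {N} (A : Subset N) (R : ℕ → ℕ → Set) →
  (∀ a b → toℕ a ≤ toℕ b → R (toℕ b ∸ toℕ a) (toℕ (emb A b) ∸ toℕ (emb A a))) →
  ∀ a b → R (dist a b) (dist (emb A a) (emb A b))
emb-dist A R ordered a b with ≤-total (toℕ a) (toℕ b)
... | inj₁ a≤b = subst₂ R (sym (m≤n⇒∣m-n∣≡n∸m a≤b)) (sym (m≤n⇒∣m-n∣≡n∸m (emb-mono A a b a≤b)))
                   (ordered a b a≤b)
... | inj₂ b≤a = subst₂ R (sym (m≤n⇒∣n-m∣≡n∸m b≤a)) (sym (m≤n⇒∣n-m∣≡n∸m (emb-mono A b a b≤a)))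
                   (ordered b a b≤a)

spread : ∀ {n N} s (e : Fin n → Fin N) → (∀ a b → toℕ a < toℕ b → toℕ (e a) + s ≤ toℕ (e b)) →
  ∀ a b → toℕ a ≤ toℕ b → toℕ (e a) + s * (toℕ b ∸ toℕ a) ≤ toℕ (e b)
spread s e sep fzero fzero _ = ≤-reflexive (trans (cong (toℕ (e fzero) +_) (*-zeroʳ s)) (+-identityʳ _))
spread s e sep fzero (fsuc fzero) _ =
  subst (λ z → toℕ (e fzero) + z ≤ toℕ (e (fsuc fzero))) (sym (*-identityʳ s))
    (sep fzero (fsuc fzero) (s≤s z≤n))
spread s e sep fzero (fsuc (fsuc b)) _ = begin
  toℕ (e fzero) + s * suc (suc (toℕ b))
    ≡⟨ cong (toℕ (e fzero) +_) (*-suc s (suc (toℕ b))) ⟩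
  toℕ (e fzero) + (s + s * suc (toℕ b))
    ≡⟨ +-assoc (toℕ (e fzero)) s _ ⟨
  toℕ (e fzero) + s + s * suc (toℕ b)
    ≤⟨ +-monoˡ-≤ _ (sep fzero (fsuc fzero) (s≤s z≤n)) ⟩
  toℕ (e (fsuc fzero)) + s * suc (toℕ b)
    ≤⟨ spread s (e ∘ fsuc) (λ a b → sep (fsuc a) (fsuc b) ∘ s≤s) fzero (fsuc b) z≤n ⟩
  toℕ (e (fsuc (fsuc b))) ∎
spread s e sep (fsuc a) (fsuc b) (s≤s a≤b) =
  spread s (e ∘ fsuc) (λ a b → sep (fsuc a) (fsuc b) ∘ s≤s) a b a≤b

-- The elements of an s-stable set are s apart, so its induced path
-- multiplies distances by s.
stable-stretches : ∀ {N} s₁ s₂ (A : Subset N) → Stable s₁ A → Stretches A s₂ (s₁ * s₂)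
stable-stretches s₁ s₂ A stableA a b _ s₂≤ =
  emb-dist A (λ u v → s₂ ≤ u → s₁ * s₂ ≤ v) ordered a b s₂≤
  where
  separated : ∀ a b → toℕ a < toℕ b → toℕ (emb A a) + s₁ ≤ toℕ (emb A b)
  separated a b a<b = subst (toℕ (emb A a) + s₁ ≤_) (m+[n∸m]≡n ea≤eb) (+-monoʳ-≤ _ s₁≤)
    where
    a≢b : ¬ a ≡ b
    a≢b a≡b = <-irrefl (cong toℕ a≡b) a<b
    ea≤eb = emb-mono A a b (<⇒≤ a<b)
    s₁≤ : s₁ ≤ toℕ (emb A b) ∸ toℕ (emb A a)
    s₁≤ = subst (s₁ ≤_) (m≤n⇒∣m-n∣≡n∸m ea≤eb)
      (stableA _ _ (true⇒∈ (emb-∈ A a)) (true⇒∈ (emb-∈ A b)) (a≢b ∘ emb-injective A a b))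
  ordered : ∀ a b → toℕ a ≤ toℕ b → s₂ ≤ toℕ b ∸ toℕ a →
    s₁ * s₂ ≤ toℕ (emb A b) ∸ toℕ (emb A a)
  ordered a b a≤b s₂≤ = begin
    s₁ * s₂                               ≤⟨ *-monoʳ-≤ s₁ s₂≤ ⟩
    s₁ * (toℕ b ∸ toℕ a)                  ≤⟨ m+n≤o⇒n≤o∸m _ (spread s₁ (emb A) separated a b a≤b) ⟩
    toℕ (emb A b) ∸ toℕ (emb A a)         ∎

-- Let A ⊆ U with ∣ U ∣ = d·n' + 1, where every rank window
-- [d(k - 1) + 1, dk + 1] of U (1 ≤ k ≤ n') contains exactly one point of A.
-- Then any d·t + 1 consecutive ranks contain at most t + 1 points of A, and
-- hence t + 2 points of A span at least d·t + 1 positions of the path.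
module RankWindows {N : ℕ} (d : ℕ) .{{_ : NonZero d}} (U A : Subset N) (n' : ℕ)
  (A⊆U : ∀ x → lookup A x ≡ true → lookup U x ≡ true)
  (∣U∣≡ : ∣ U ∣ ≡ d * n' + 1)
  (window : ∀ k → 1 ≤ k → k ≤ n' → ∣ A ∩ Window U (d * (k ∸ 1) + 1) (d * k + 1) ∣ ≡ 1) where

  ρ : Fin N → ℕ
  ρ x = count (λ z → lookup U z ∧ (toℕ z ≤ᵇ toℕ x))

  ρ-mono : ∀ x y → toℕ x ≤ toℕ y → ρ x ≤ ρ y
  ρ-mono x y x≤y = count-mono λ z e → case ∧-true (lookup U z) e of λ where
    (z∈U , z≤x) → cong₂ _∧_ z∈U (≤ᵇ-complete (≤-trans (≤ᵇ-sound (toℕ z) (toℕ x) z≤x) x≤y))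

  ρ-bounded : ∀ x → ρ x ≤ d * n' + 1
  ρ-bounded x = subst (ρ x ≤_) (trans (sym (∣∣≡count U)) ∣U∣≡)
    (count-mono λ z e → proj₁ (∧-true (lookup U z) e))

  ρ-pos : ∀ x → lookup U x ≡ true → 1 ≤ ρ x
  ρ-pos x x∈U = count-pos _ x (cong₂ _∧_ x∈U (≤ᵇ-complete (≤-refl {toℕ x})))

  ρ-gap : ∀ x y → toℕ x ≤ toℕ y → ρ y ≤ ρ x + (toℕ y ∸ toℕ x)
  ρ-gap x y x≤y = begin
    ρ y
      ≡⟨ count-split f g ⟩
    count (λ z → f z ∧ g z) + count (λ z → f z ∧ not (g z))
      ≤⟨ +-mono-≤ (count-mono upTo-x) (count-mono after-x) ⟩
    ρ x + count {N} (λ z → (suc (toℕ x) ≤ᵇ toℕ z) ∧ (toℕ z ≤ᵇ toℕ y))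
      ≡⟨ cong (ρ x +_) (count-interval (suc (toℕ x)) (toℕ y) (toℕ<n y)) ⟩
    ρ x + (toℕ y ∸ toℕ x) ∎
    where
    f g : Fin N → Bool
    f z = lookup U z ∧ (toℕ z ≤ᵇ toℕ y)
    g z = toℕ z ≤ᵇ toℕ x
    upTo-x : ∀ z → (f z ∧ g z) ≡ true → (lookup U z ∧ (toℕ z ≤ᵇ toℕ x)) ≡ true
    upTo-x z e with ∧-true (f z) e
    ... | fz , z≤x = cong₂ _∧_ (proj₁ (∧-true (lookup U z) fz)) z≤x
    after-x : ∀ z → (f z ∧ not (g z)) ≡ true → ((suc (toℕ x) ≤ᵇ toℕ z) ∧ (toℕ z ≤ᵇ toℕ y)) ≡ true
    after-x z e with ∧-true (f z) e
    ... | fz , z≰x = cong₂ _∧_ (≤ᵇ-complete (≤ᵇ-false (toℕ z) (toℕ x) (not-true z≰x)))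
                               (proj₂ (∧-true (lookup U z) fz))

  inRanks : ℕ → ℕ → Fin N → Bool
  inRanks lo hi x = (lo ≤ᵇ ρ x) ∧ (ρ x ≤ᵇ hi)

  hits : ℕ → ℕ → ℕ
  hits lo hi = count (λ x → lookup A x ∧ inRanks lo hi x)

  hits≡Window : ∀ lo hi → ∣ A ∩ Window U lo hi ∣ ≡ hits lo hi
  hits≡Window lo hi = trans (∣∩∣≡count A (Window U lo hi)) (count-cong same)
    where
    ρ≡rank : ∀ x → rank U x ≡ ρ x
    ρ≡rank x = trans (∣∩∣≡count U _) (count-cong λ z → cong (lookup U z ∧_) (lookup∘tabulate _ z))
    same : ∀ x → (lookup A x ∧ lookup (Window U lo hi) x) ≡ (lookup A x ∧ inRanks lo hi x)
    same x with lookup A x in x∈A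
    ... | false = refl
    ... | true = trans (lookup∘tabulate _ x)
                   (cong₂ (λ u r → u ∧ ((lo ≤ᵇ r) ∧ (r ≤ᵇ hi))) (A⊆U x x∈A) (ρ≡rank x))

  hits-mono : ∀ {lo hi lo' hi'} → lo' ≤ lo → hi ≤ hi' → hits lo hi ≤ hits lo' hi'
  hits-mono {lo} {hi} lo'≤lo hi≤hi' = count-mono λ x e → case ∧-true (lookup A x) e of λ where
    (x∈A , r) → case ∧-true (lo ≤ᵇ ρ x) r of λ where
      (lo≤ , ≤hi) → cong₂ _∧_ x∈A (cong₂ _∧_ (≤ᵇ-complete (≤-trans lo'≤lo (≤ᵇ-sound lo (ρ x) lo≤)))
                                            (≤ᵇ-complete (≤-trans (≤ᵇ-sound (ρ x) hi ≤hi) hi≤hi')))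

  hits-top : ∀ lo hi → hits lo hi ≤ hits lo (d * n' + 1)
  hits-top lo hi = count-mono λ x e → case ∧-true (lookup A x) e of λ where
    (x∈A , r) → cong₂ _∧_ x∈A
      (cong₂ _∧_ (proj₁ (∧-true (lo ≤ᵇ ρ x) r)) (≤ᵇ-complete (ρ-bounded x)))

  hits-split : ∀ lo mid hi → hits lo hi ≤ hits lo mid + hits (suc mid) hi
  hits-split lo mid hi = ≤-trans (count-mono cases)
    (count-∨ (λ x → lookup A x ∧ inRanks lo mid x) (λ x → lookup A x ∧ inRanks (suc mid) hi x))
    where
    cases : ∀ x → (lookup A x ∧ inRanks lo hi x) ≡ true →
      ((lookup A x ∧ inRanks lo mid x) ∨ (lookup A x ∧ inRanks (suc mid) hi x)) ≡ true
    cases x e with ∧-true (lookup A x) e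
    ... | x∈A , r with ∧-true (lo ≤ᵇ ρ x) r | ρ x ≤? mid
    ... | lo≤ , _ | yes ≤mid rewrite x∈A | lo≤ | ≤ᵇ-complete ≤mid = refl
    ... | _ , ≤hi | no >mid rewrite x∈A | ≤hi | ≤ᵇ-complete (≰⇒> {ρ x} {mid} >mid) = ∨-zeroʳ _

  winStart winEnd : ℕ → ℕ
  winStart k = d * (k ∸ 1) + 1
  winEnd k = d * k + 1

  -- Every window, also beyond the n'-th, contains at most one point of A.
  hits-window : ∀ k → 1 ≤ k → hits (winStart k) (winEnd k) ≤ 1
  hits-window k 1≤k with k ≤? n' | 1 ≤? n'
  ... | yes k≤n' | _ = ≤-reflexive (trans (sym (hits≡Window (winStart k) (winEnd k))) (window k 1≤k k≤n'))
  ... | no k≰n' | yes 1≤n' = begin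
    hits (winStart k) (winEnd k)
      ≤⟨ hits-top (winStart k) (winEnd k) ⟩
    hits (winStart k) (winEnd n')
      ≤⟨ hits-mono (+-monoˡ-≤ 1 (*-monoʳ-≤ d (∸-monoˡ-≤ 1 (<⇒≤ (≰⇒> k≰n'))))) ≤-refl ⟩
    hits (winStart n') (winEnd n')
      ≡⟨ sym (hits≡Window (winStart n') (winEnd n')) ⟩
    ∣ A ∩ Window U (winStart n') (winEnd n') ∣
      ≡⟨ window n' 1≤n' ≤-refl ⟩
    1 ∎
  ... | no _ | no 1≰n' = begin
    hits (winStart k) (winEnd k)  ≤⟨ count-mono (λ x e → A⊆U x (proj₁ (∧-true (lookup A x) e))) ⟩
    count (lookup U)              ≡⟨ trans (sym (∣∣≡count U)) ∣U∣≡ ⟩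
    d * n' + 1                    ≡⟨ cong (λ n → d * n + 1) (n<1⇒n≡0 (≰⇒> 1≰n')) ⟩
    d * 0 + 1                     ≡⟨ cong (_+ 1) (*-zeroʳ d) ⟩
    1                             ∎

  hits-block : ∀ t k → 1 ≤ k → hits (winStart k) (winEnd (k + t)) ≤ suc t
  hits-block zero k 1≤k rewrite +-identityʳ k = hits-window k 1≤k
  hits-block (suc t) k 1≤k = begin
    hits (winStart k) (winEnd (k + suc t))
      ≤⟨ hits-split (winStart k) (winEnd k) (winEnd (k + suc t)) ⟩
    hits (winStart k) (winEnd k) + hits (suc (winEnd k)) (winEnd (k + suc t))
      ≤⟨ +-mono-≤ (hits-window k 1≤k) (hits-mono (n≤1+n _) (≤-reflexive (cong winEnd (+-suc k t)))) ⟩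
    1 + hits (winStart (suc k)) (winEnd (suc k + t))
      ≤⟨ +-monoʳ-≤ 1 (hits-block t (suc k) (s≤s z≤n)) ⟩
    suc (suc t) ∎

  -- Any d·t + 1 consecutive ranks lie in t + 1 consecutive windows.
  hits-short : ∀ lo hi t → 1 ≤ lo → hi ≤ lo + d * t → hits lo hi ≤ suc t
  hits-short (suc L) hi t _ hi≤ =
    ≤-trans (hits-mono lo-covered hi-covered) (hits-block t (suc k) (s≤s z≤n))
    where
    k = L / d
    lo-covered : d * k + 1 ≤ suc L
    lo-covered = subst (_≤ suc L) (+-comm 1 (d * k)) (s≤s (subst (_≤ L) (*-comm k d) (m/n*n≤m L d)))
    L≤ : L ≤ d * suc k
    L≤ = begin
      L                 ≡⟨ m≡m%n+[m/n]*n L d ⟩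
      L % d + k * d     ≤⟨ +-monoˡ-≤ (k * d) (<⇒≤ (m%n<n L d)) ⟩
      d + k * d         ≡⟨ cong (d +_) (*-comm k d) ⟩
      d + d * k         ≡⟨ *-suc d k ⟨
      d * suc k         ∎
    hi-covered : hi ≤ d * (suc k + t) + 1
    hi-covered = begin
      hi                        ≤⟨ hi≤ ⟩
      suc L + d * t             ≤⟨ +-monoˡ-≤ (d * t) (s≤s L≤) ⟩
      suc (d * suc k) + d * t   ≡⟨ cong suc (*-distribˡ-+ d (suc k) t) ⟨
      suc (d * (suc k + t))     ≡⟨ +-comm 1 _ ⟩
      d * (suc k + t) + 1       ∎

  hits-emb : ∀ a b → toℕ a ≤ toℕ b → suc (toℕ b ∸ toℕ a) ≤ hits (ρ (emb A a)) (ρ (emb A b))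
  hits-emb a b a≤b = begin
    suc (toℕ b ∸ toℕ a)
      ≡⟨ +-∸-assoc 1 a≤b ⟨
    suc (toℕ b) ∸ toℕ a
      ≡⟨ count-interval (toℕ a) (toℕ b) (toℕ<n b) ⟨
    count {∣ A ∣} (λ y → (toℕ a ≤ᵇ toℕ y) ∧ (toℕ y ≤ᵇ toℕ b))
      ≤⟨ count-mono between ⟩
    count (inRanks (ρ (emb A a)) (ρ (emb A b)) ∘ emb A)
      ≡⟨ count-emb A (inRanks (ρ (emb A a)) (ρ (emb A b))) ⟨
    hits (ρ (emb A a)) (ρ (emb A b)) ∎
    where
    between : ∀ y → ((toℕ a ≤ᵇ toℕ y) ∧ (toℕ y ≤ᵇ toℕ b)) ≡ true →
      inRanks (ρ (emb A a)) (ρ (emb A b)) (emb A y) ≡ true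
    between y e with ∧-true (toℕ a ≤ᵇ toℕ y) e
    ... | a≤y , y≤b = cong₂ _∧_
      (≤ᵇ-complete (ρ-mono _ _ (emb-mono A a y (≤ᵇ-sound (toℕ a) (toℕ y) a≤y))))
      (≤ᵇ-complete (ρ-mono _ _ (emb-mono A y b (≤ᵇ-sound (toℕ y) (toℕ b) y≤b))))

  gap : ∀ t a b → toℕ a ≤ toℕ b → suc t ≤ toℕ b ∸ toℕ a →
    d * t + 1 ≤ toℕ (emb A b) ∸ toℕ (emb A a)
  gap t a b a≤b t<b-a = +-cancelˡ-≤ (ρ ea) _ _ (begin
    ρ ea + (d * t + 1)                ≡⟨ trans (cong (ρ ea +_) (+-comm (d * t) 1)) (+-suc (ρ ea) (d * t)) ⟩
    suc (ρ ea + d * t)                ≤⟨ ranks-far ⟩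
    ρ eb                              ≤⟨ ρ-gap ea eb (emb-mono A a b a≤b) ⟩
    ρ ea + (toℕ eb ∸ toℕ ea)          ∎)
    where
    ea = emb A a
    eb = emb A b
    -- Otherwise t + 2 points of A would have ranks in d·t + 1 consecutive ranks.
    ranks-far : ρ ea + d * t < ρ eb
    ranks-far with ρ eb ≤? ρ ea + d * t
    ... | no ρeb≰ = ≰⇒> ρeb≰
    ... | yes ρeb≤ = ⊥-elim (<-irrefl refl (begin-strict
      suc t                        <⟨ s≤s t<b-a ⟩
      suc (toℕ b ∸ toℕ a)          ≤⟨ hits-emb a b a≤b ⟩
      hits (ρ ea) (ρ eb)           ≤⟨ hits-short (ρ ea) (ρ eb) t (ρ-pos ea (A⊆U ea (emb-∈ A a))) ρeb≤ ⟩
      suc t                        ∎))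

⊆Union : ∀ {N r} (A : Fin r → Subset N) k x → lookup (A k) x ≡ true → lookup (Union A) x ≡ true
⊆Union A k x x∈ = trans (lookup-Union A x) (any-intro (λ i → lookup (A i) x) k x∈)

distinct-dist : ∀ {n} s (a b : Fin n) → ¬ a ≡ b → s ≤ dist a b → suc (s ∸ 1) ≤ dist a b
distinct-dist (suc t) a b _ s≤ = s≤
distinct-dist zero a b a≢b _ with dist a b in eq
... | zero = ⊥-elim (a≢b (toℕ-injective (∣m-n∣≡0⇒m≡n eq)))
... | suc _ = s≤s z≤n

weakly-stable-stretches : ∀ {N r} w s (A : Fin r → Subset N) → 2 ≤ w → WeaklyStable w A →
  ∀ k → Stretches (A k) s ((s ∸ 1) * (w ∸ 1) + 1)
weakly-stable-stretches (suc zero) s A (s≤s ()) _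
weakly-stable-stretches (suc (suc w')) s A _ (n' , ∣U∣≡ , windows) k a b a≢b s≤ =
  emb-dist (A k) (λ u v → suc (s ∸ 1) ≤ u → (s ∸ 1) * suc w' + 1 ≤ v) ordered a b
    (distinct-dist s a b a≢b s≤)
  where
  open RankWindows (suc w') (Union A) (A k) n' (⊆Union A k) ∣U∣≡ (windows k) using (gap)
  ordered : ∀ a b → toℕ a ≤ toℕ b → suc (s ∸ 1) ≤ toℕ b ∸ toℕ a →
    (s ∸ 1) * suc w' + 1 ≤ toℕ (emb (A k) b) ∸ toℕ (emb (A k) a)
  ordered a b a≤b far = subst (λ z → z + 1 ≤ toℕ (emb (A k) b) ∸ toℕ (emb (A k) a))
    (*-comm (suc w') (s ∸ 1)) (gap (s ∸ 1) a b a≤b far)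

∸1≤⇒≤+1 : ∀ {a b} → a ∸ 1 ≤ b → a ≤ b + 1
∸1≤⇒≤+1 {zero} _ = z≤n
∸1≤⇒≤+1 {suc a} {b} h = subst (suc a ≤_) (+-comm 1 b) (s≤s h)

share-large : ∀ q₁ q₂ v .{{_ : NonZero q₁}} → q₁ * q₂ ∸ 1 ≤ v → q₂ ≤ (v + 1) / q₁
share-large q₁ q₂ v q₁q₂-1≤v = begin
  q₂               ≡⟨ m*n/n≡m q₂ q₁ ⟨
  q₂ * q₁ / q₁     ≤⟨ /-monoˡ-≤ q₁ (subst (_≤ v + 1) (*-comm q₁ q₂) (∸1≤⇒≤+1 q₁q₂-1≤v)) ⟩
  (v + 1) / q₁     ∎

share-of-share : ∀ q₁ q₂ v x y .{{_ : NonZero q₁}} .{{_ : NonZero q₂}} .{{_ : NonZero (q₁ * q₂)}} →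
  (v + 1) / q₁ ∸ 1 ≤ x → (x + 1) / q₂ ∸ 1 ≤ y → (v + 1) / (q₁ * q₂) ∸ 1 ≤ y
share-of-share q₁ q₂ v x y u-1≤x share≤y = ≤-trans (∸-monoˡ-≤ 1 shares) share≤y
  where
  shares : (v + 1) / (q₁ * q₂) ≤ (x + 1) / q₂
  shares = subst (_≤ (x + 1) / q₂) (m/n/o≡m/[n*o] (v + 1) q₁ q₂) (/-monoˡ-≤ q₂ (∸1≤⇒≤+1 u-1≤x))

-- At most q₁ - 1 points missed by the A's plus q₂ - 1 missed inside each Aₖ.
leftover-total : ∀ q₁ q₂ .{{_ : NonZero q₂}} → (q₁ ∸ 1) + q₁ * (q₂ ∸ 1) ≡ q₁ * q₂ ∸ 1
leftover-total zero (suc b) = refl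
leftover-total (suc a) (suc b) = begin-equality
  a + (b + a * b)   ≡⟨ +-assoc a b (a * b) ⟨
  (a + b) + a * b   ≡⟨ cong (_+ a * b) (+-comm a b) ⟩
  (b + a) + a * b   ≡⟨ +-assoc b a (a * b) ⟩
  b + (a + a * b)   ≡⟨ cong (b +_) (*-suc a b) ⟨
  b + a * suc b     ∎

lookup-Part-restrict : ∀ {N m} (A : Subset N) (c : Fin N → Fin m) j y →
  lookup (Part (c ∘ emb A) j) y ≡ lookup (Part c j) (emb A y)
lookup-Part-restrict A c j y = trans (lookup∘tabulate _ y) (sym (lookup∘tabulate _ (emb A y)))

∣Part-restrict∣ : ∀ {N m} (A : Subset N) (c : Fin N → Fin m) j →
  ∣ Part (c ∘ emb A) j ∣ ≡ ∣ A ∩ Part c j ∣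
∣Part-restrict∣ A c j = begin-equality
  ∣ Part (c ∘ emb A) j ∣                               ≡⟨ ∣∣≡count (Part (c ∘ emb A) j) ⟩
  count (lookup (Part (c ∘ emb A) j))                  ≡⟨ count-cong (lookup-Part-restrict A c j) ⟩
  count (lookup (Part c j) ∘ emb A)                    ≡⟨ count-emb A (lookup (Part c j)) ⟨
  count (λ x → lookup A x ∧ lookup (Part c j) x)       ≡⟨ ∣∩∣≡count A (Part c j) ⟨
  ∣ A ∩ Part c j ∣                                     ∎

∣push∩Part∣ : ∀ {N m} (A : Subset N) (B : Subset ∣ A ∣) (c : Fin N → Fin m) j →
  ∣ push A B ∩ Part c j ∣ ≡ ∣ B ∩ Part (c ∘ emb A) j ∣
∣push∩Part∣ A B c j = begin-equality
  ∣ push A B ∩ Part c j ∣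
    ≡⟨ ∣∩∣≡count (push A B) (Part c j) ⟩
  count (λ x → lookup (push A B) x ∧ lookup (Part c j) x)
    ≡⟨ count-within A _ (λ x e → push-⊆ A B x (proj₁ (∧-true (lookup (push A B) x) e))) ⟩
  count (λ y → lookup (push A B) (emb A y) ∧ lookup (Part c j) (emb A y))
    ≡⟨ count-cong (λ y → cong₂ _∧_ (push-emb A B y) (sym (lookup-Part-restrict A c j y))) ⟩
  count (λ y → lookup B y ∧ lookup (Part (c ∘ emb A) j) y)
    ≡⟨ ∣∩∣≡count B (Part (c ∘ emb A) j) ⟨
  ∣ B ∩ Part (c ∘ emb A) j ∣ ∎

∣Part─Union∣-push : ∀ {N m r} (A : Subset N) (B : Fin r → Subset ∣ A ∣) (c : Fin N → Fin m) j →
  count (λ x → lookup A x ∧ (lookup (Part c j) x ∧ not (any (λ l → lookup (push A (B l)) x))))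
    ≡ ∣ Part (c ∘ emb A) j ─ Union B ∣
∣Part─Union∣-push A B c j = begin-equality
  count (λ x → lookup A x ∧ (lookup (Part c j) x ∧ not (any (λ l → lookup (push A (B l)) x))))
    ≡⟨ count-emb A _ ⟩
  count (λ y → lookup (Part c j) (emb A y) ∧ not (any (λ l → lookup (push A (B l)) (emb A y))))
    ≡⟨ count-cong (λ y → cong₂ (λ u v → u ∧ not v) (sym (lookup-Part-restrict A c j y))
                                                  (any-cong (λ l → push-emb A (B l) y))) ⟩
  count (λ y → lookup (Part (c ∘ emb A) j) y ∧ not (any (λ l → lookup (B l) y)))
    ≡⟨ ∣─Union∣≡count (Part (c ∘ emb A) j) B ⟨
  ∣ Part (c ∘ emb A) j ─ Union B ∣ ∎

disjoint-elim : ∀ {N} {p q : Subset N} → Empty (p ∩ q) →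
  ∀ x → lookup p x ≡ true → lookup q x ≡ true → ⊥
disjoint-elim {p = p} {q} empty x x∈p x∈q =
  empty (x , true⇒∈ (trans (lookup-∩ p q x) (cong₂ _∧_ x∈p x∈q)))

disjoint-intro : ∀ {N} {p q : Subset N} →
  (∀ x → lookup p x ≡ true → lookup q x ≡ true → ⊥) → Empty (p ∩ q)
disjoint-intro {p = p} {q} apart (x , x∈) with ∧-true (lookup p x) (trans (sym (lookup-∩ p q x)) (∈⇒true x∈))
... | x∈p , x∈q = apart x x∈p x∈q

push-disjoint : ∀ {N} (A : Subset N) {B B' : Subset ∣ A ∣} → Empty (B ∩ B') → Empty (push A B ∩ push A B')
push-disjoint A {B} {B'} empty = disjoint-intro λ x x∈ x∈' →
  case push-preimage A B x x∈ , push-preimage A B' x x∈' of λ where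
    ((y , refl , y∈B) , (y' , ey' , y'∈B')) →
      disjoint-elim empty y y∈B (subst (λ z → lookup B' z ≡ true) (emb-injective A y' y ey') y'∈B')

flatten : ∀ {N q₁} q₂ → (Fin q₁ → Fin q₂ → Subset N) → Fin (q₁ * q₂) → Subset N
flatten {q₁ = q₁} q₂ T i = uncurry T (remQuot {q₁} q₂ i)

flatten-disjoint : ∀ {N q₁} q₂ (T : Fin q₁ → Fin q₂ → Subset N) →
  (∀ k l k' l' → ¬ (k , l) ≡ (k' , l') → Empty (T k l ∩ T k' l')) → PairwiseDisjoint (flatten q₂ T)
flatten-disjoint {q₁ = q₁} q₂ T apart i i' i≢i' = apart _ _ _ _ λ same → i≢i' (trans
  (sym (combine-remQuot {q₁} q₂ i))
  (trans (cong (uncurry combine) same) (combine-remQuot {q₁} q₂ i')))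

flatten-uncovered : ∀ {N q₁} q₂ (T : Fin q₁ → Fin q₂ → Subset N) x →
  any (λ i → lookup (flatten q₂ T i) x) ≡ false → ∀ k l → lookup (T k l) x ≡ false
flatten-uncovered {q₁ = q₁} q₂ T x none k l =
  subst (λ S → lookup S x ≡ false) (cong (uncurry T) (remQuot-combine {q₁} {q₂} k l))
    (any-false (λ i → lookup (flatten q₂ T i) x) none (combine k l))

module Refinement {m q₁ q₂ s₂ s : ℕ} .{{_ : NonZero q₁}} .{{_ : NonZero q₂}}
  (split₂ : Splittable m q₂ s₂ NoExtra)
  {N : ℕ} (c : Fin N → Fin m) (large : ∀ j → q₁ * q₂ ∸ 1 ≤ ∣ Part c j ∣)
  (A : Fin q₁ → Subset N) (disjointA : PairwiseDisjoint A) (fairA : AlmostFair q₁ c A)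
  (stretch : ∀ k → Stretches (A k) s₂ s) where

  instance
    q₁q₂≢0 : NonZero (q₁ * q₂)
    q₁q₂≢0 = m*n≢0 q₁ q₂

  cₖ : (k : Fin q₁) → Fin ∣ A k ∣ → Fin m
  cₖ k = c ∘ emb (A k)

  -- Its parts are fair q₁-shares of parts of size ≥ q₁q₂ - 1, so of size ≥ q₂ - 1.
  large₂ : ∀ k j → q₂ ∸ 1 ≤ ∣ Part (cₖ k) j ∣
  large₂ k j = subst (q₂ ∸ 1 ≤_) (sym (∣Part-restrict∣ (A k) c j))
    (≤-trans (∸-monoˡ-≤ 1 (share-large q₁ q₂ _ (large j))) (proj₁ fairA k j))

  splitₖ : ∀ k → Σ (Fin q₂ → Subset ∣ A k ∣) (λ B →
    PairwiseDisjoint B × (∀ l → Stable s₂ (B l)) × AlmostFair q₂ (cₖ k) B × NoExtra B)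
  splitₖ k = split₂ ∣ A k ∣ (cₖ k) (large₂ k)

  B : ∀ k → Fin q₂ → Subset ∣ A k ∣
  B k = proj₁ (splitₖ k)

  B-disjoint : ∀ k → PairwiseDisjoint (B k)
  B-disjoint k = proj₁ (proj₂ (splitₖ k))

  B-stable : ∀ k l → Stable s₂ (B k l)
  B-stable k = proj₁ (proj₂ (proj₂ (splitₖ k)))

  B-fair : ∀ k → AlmostFair q₂ (cₖ k) (B k)
  B-fair k = proj₁ (proj₂ (proj₂ (proj₂ (splitₖ k))))

  T : Fin q₁ → Fin q₂ → Subset N
  T k l = push (A k) (B k l)

  S : Fin (q₁ * q₂) → Subset N
  S = flatten q₂ T

  T-disjoint : ∀ k l k' l' → ¬ (k , l) ≡ (k' , l') → Empty (T k l ∩ T k' l')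
  T-disjoint k l k' l' kl≢ with k ≟ᶠ k'
  ... | no k≢k' = disjoint-intro λ x x∈ x∈' →
    disjoint-elim (disjointA k k' k≢k') x (push-⊆ (A k) (B k l) x x∈) (push-⊆ (A k') (B k' l') x x∈')
  ... | yes refl = push-disjoint (A k) (B-disjoint k l l' (kl≢ ∘ cong (k ,_)))

  T-stable : ∀ k l → Stable s (T k l)
  T-stable k l = push-stable (A k) (B k l) (stretch k) (B-stable k l)

  T-fair : ∀ k l j → (∣ Part c j ∣ + 1) / (q₁ * q₂) ∸ 1 ≤ ∣ T k l ∩ Part c j ∣
  T-fair k l j = subst (_ ≤_) (sym (∣push∩Part∣ (A k) (B k l) c j))
    (share-of-share q₁ q₂ (∣ Part c j ∣) (∣ Part (cₖ k) j ∣) (∣ B k l ∩ Part (cₖ k) j ∣)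
      (subst (_ ≤_) (sym (∣Part-restrict∣ (A k) c j)) (proj₁ fairA k j)) (proj₁ (B-fair k) l j))

  missed : ∀ j x →
    (lookup (Part c j) x ∧ not (any (λ i → lookup (S i) x))) ≡ true →
    ((lookup (Part c j) x ∧ not (any (λ k → lookup (A k) x)))
      ∨ any (λ k → lookup (A k) x ∧ (lookup (Part c j) x ∧ not (any (λ l → lookup (T k l) x))))) ≡ true
  missed j x e with ∧-true (lookup (Part c j) x) e
  ... | x∈Vj , x∉S with any (λ k → lookup (A k) x) in inA
  ... | false rewrite x∈Vj = refl
  ... | true with any-elim (λ k → lookup (A k) x) inA
  ... | k , x∈Ak = trans (cong (_ ∨_) (any-intro _ k in-block)) (∨-zeroʳ _)
    where
    in-block : (lookup (A k) x ∧ (lookup (Part c j) x ∧ not (any (λ l → lookup (T k l) x)))) ≡ true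
    in-block rewrite x∈Ak | x∈Vj
      | any-none (λ l → lookup (T k l) x) (flatten-uncovered q₂ T x (not-true x∉S) k) = refl

  leftover : ∀ j → ∣ Part c j ─ Union S ∣ ≤ q₁ * q₂ ∸ 1
  leftover j = begin
    ∣ Part c j ─ Union S ∣
      ≡⟨ ∣─Union∣≡count (Part c j) S ⟩
    count (λ x → lookup (Part c j) x ∧ not (any (λ i → lookup (S i) x)))
      ≤⟨ count-mono (missed j) ⟩
    count (λ x → missedA x ∨ any (λ k → missedₖ k x))
      ≤⟨ count-∨ missedA (λ x → any (λ k → missedₖ k x)) ⟩
    count missedA + count (λ x → any (λ k → missedₖ k x))
      ≤⟨ +-mono-≤ (≤-reflexive (sym (∣─Union∣≡count (Part c j) A))) (count-any missedₖ (q₂ ∸ 1) missedₖ-few) ⟩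
    ∣ Part c j ─ Union A ∣ + q₁ * (q₂ ∸ 1)
      ≤⟨ +-monoˡ-≤ _ (proj₂ fairA j) ⟩
    (q₁ ∸ 1) + q₁ * (q₂ ∸ 1)
      ≡⟨ leftover-total q₁ q₂ ⟩
    q₁ * q₂ ∸ 1 ∎
    where
    missedA : Fin N → Bool
    missedA x = lookup (Part c j) x ∧ not (any (λ k → lookup (A k) x))
    missedₖ : Fin q₁ → Fin N → Bool
    missedₖ k x = lookup (A k) x ∧ (lookup (Part c j) x ∧ not (any (λ l → lookup (T k l) x)))
    missedₖ-few : ∀ k → count (missedₖ k) ≤ q₂ ∸ 1
    missedₖ-few k = subst (_≤ q₂ ∸ 1) (sym (∣Part─Union∣-push (A k) (B k) c j)) (proj₂ (B-fair k) j)

  splitting : Σ (Fin (q₁ * q₂) → Subset N) (λ S →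
    PairwiseDisjoint S × (∀ i → Stable s (S i)) × AlmostFair (q₁ * q₂) c S × NoExtra S)
  splitting = S , flatten-disjoint q₂ T T-disjoint
    , (λ i → uncurry T-stable (remQuot q₂ i))
    , ((λ i → uncurry T-fair (remQuot q₂ i)) , leftover) , tt

large₁ : ∀ {N m} q₁ q₂ .{{_ : NonZero q₂}} (c : Fin N → Fin m) →
  (∀ j → q₁ * q₂ ∸ 1 ≤ ∣ Part c j ∣) → ∀ j → q₁ ∸ 1 ≤ ∣ Part c j ∣
large₁ q₁ q₂ c large j = ≤-trans (∸-monoˡ-≤ 1 (m≤m*n q₁ q₂)) (large j)

theorem6p6 : (m q₁ q₂ s₁ s₂ : ℕ) →
    .{{_ : NonZero m}} → {{_ : NonZero q₁}} → {{_ : NonZero q₂}} →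
    .{{_ : NonZero s₁}} → .{{_ : NonZero s₂}} →
    (Splittable m q₁ s₁ NoExtra → Splittable m q₂ s₂ NoExtra →
       Splittable m (q₁ * q₂) (s₁ * s₂) {{m*n≢0 q₁ q₂}} NoExtra)
    ×
    (∀ (w₁ : ℕ) → 2 ≤ w₁ →
       Splittable m q₁ s₁ (WeaklyStable w₁) → Splittable m q₂ s₂ NoExtra →
       Splittable m (q₁ * q₂) ((s₂ ∸ 1) * (w₁ ∸ 1) + 1) {{m*n≢0 q₁ q₂}} NoExtra)
theorem6p6 m q₁ q₂ s₁ s₂ =
  (λ split₁ split₂ N c large →
    let A , disjoint , stable , fair , _ = split₁ N c (large₁ q₁ q₂ c large)
    in Refinement.splitting split₂ c large A disjoint fair (λ k → stable-stretches s₁ s₂ (A k) (stable k)))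
  ,
  (λ w₁ 2≤w₁ split₁ split₂ N c large →
    let A , disjoint , _ , fair , weak = split₁ N c (large₁ q₁ q₂ c large)
    in Refinement.splitting split₂ c large A disjoint fair (weakly-stable-stretches w₁ s₂ A 2≤w₁ weak))
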